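{- Let $H$ be a strongly connected digraph and let $\mu$ be a minimal butterfly minor model of $H$ in a digraph $G$. Then $\mu(H)$ is strongly connected.
   Context: A butterfly minor model of $H$ in $G$ is a function $\mu$ on $V(H)\cup E(H)$ such that: for every $v\in V(H)$, $\mu(v)$ is a subdigraph of $G$ that is an orientation of a tree, whose vertex set is partitioned as $(\{r_v\},I_v,O_v)$ so that $\mu(v)[\{r_v\}\cup O_v]$ is an out-arborescence rooted at $r_v$ and $\mu(v)[\{r_v\}\cup I_v]$ is an in-arborescence rooted at $r_v$; for distinct $v,w\in V(H)$, $\mu(v)$ and $\mu(w)$ are vertex-disjoint; for every $(x,y)\in E(H)$, $\mu((x,y))$ is an edge of $G$ with tail in $\{r_x\}\cup O_x$ and head in $\{r_y\}\cup I_y$. For a subdigraph $H'$ of $H$, $\mu(H')$ is the subdigraph of $G$ formed by $\bigcup_{v\in V(H')}\mu(v)$ together with the edges $\mu(e)$, $e\in E(H')$. The model $\mu$ is minimal if there is no butterfly minor model $\mu'$ of $H$ in $G$ such that $\mu'(H)$ is a proper subdigraph of $\mu(H)$. -}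

module Defs where

open import Data.Nat using (ℕ)
open import Data.Fin using (Fin)
open import Data.List using (List; []; _∷_)
open import Data.List.Relation.Unary.Unique.Propositional using (Unique)
open import Data.Product using (Σ; ∃; _×_; _,_)
open import Data.Sum using (_⊎_)
open import Data.Unit using (⊤)
open import Relation.Nullary using (¬_)
open import Relation.Binary.PropositionalEquality using (_≡_; _≢_)

-- A finite digraph (loops and parallel edges allowed):
-- vertices Fin nV, edges Fin nE, each edge has a tail and a head.
record Digraph : Set where
  field
    nV : ℕ
    nE : ℕ
    tail : Fin nE → Fin nV
    head : Fin nE → Fin nV
open Digraph public

_∪ᵥ_ : {A : Set} → (A → Set) → (A → Set) → A → Set
(P ∪ᵥ Q) u = P u ⊎ Q u

module _ (G : Digraph) where

  Vtx = Fin (nV G)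
  Edg = Fin (nE G)

  VPred = Vtx → Set
  EPred = Edg → Set

  IsSub : VPred → EPred → Set
  IsSub V E = ∀ e → E e → V (tail G e) × V (head G e)

  data DWalk (V : VPred) (E : EPred) : Vtx → Vtx → Set where
    dnil  : ∀ {u} → V u → DWalk V E u u
    dcons : ∀ {w} e → V (tail G e) → E e → DWalk V E (head G e) w →
            DWalk V E (tail G e) w

  StronglyConnected : VPred → EPred → Set
  StronglyConnected V E = ∀ u w → V u → V w → DWalk V E u w

  data UWalk (V : VPred) (E : EPred) : Vtx → Vtx → Set where
    unil  : ∀ {u} → V u → UWalk V E u u
    ufwd  : ∀ {w} e → V (tail G e) → E e → UWalk V E (head G e) w →
            UWalk V E (tail G e) w
    ubwd  : ∀ {w} e → V (head G e) → E e → UWalk V E (tail G e) w →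
            UWalk V E (head G e) w

  uedges : ∀ {V E u w} → UWalk V E u w → List Edg
  uedges (unil _) = []
  uedges (ufwd e _ _ p) = e ∷ uedges p
  uedges (ubwd e _ _ p) = e ∷ uedges p

  -- vertices visited, excluding the final vertex
  uinner : ∀ {V E u w} → UWalk V E u w → List Vtx
  uinner (unil _) = []
  uinner (ufwd e _ _ p) = tail G e ∷ uinner p
  uinner (ubwd e _ _ p) = head G e ∷ uinner p

  HasUCycle : VPred → EPred → Set
  HasUCycle V E = Σ Vtx λ u → Σ (UWalk V E u u) λ c →
    (uedges c ≢ []) × Unique (uedges c) × Unique (uinner c)

  IsOrientedTree : VPred → EPred → Set
  IsOrientedTree V E =
    (∃ λ u → V u) × (∀ u w → V u → V w → UWalk V E u w) × ¬ HasUCycle V E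

  -- induced subdigraph of (V , E) on the vertex set X (X ⊆ V assumed separately)
  InducedE : EPred → VPred → EPred
  InducedE E X e = E e × X (tail G e) × X (head G e)

  IsOutArb : VPred → EPred → Vtx → Set
  IsOutArb V E r = IsOrientedTree V E × V r × (∀ u → V u → DWalk V E r u)

  IsInArb : VPred → EPred → Vtx → Set
  IsInArb V E r = IsOrientedTree V E × V r × (∀ u → V u → DWalk V E u r)

  Single : Vtx → VPred
  Single r u = u ≡ r

module _ (H G : Digraph) where

  record BMModel : Set₁ where
    field
      bV   : Fin (nV H) → VPred G
      bE   : Fin (nV H) → EPred G
      root : Fin (nV H) → Vtx G
      bI   : Fin (nV H) → VPred G
      bO   : Fin (nV H) → VPred G
      eImg : Fin (nE H) → Edg G
      sub   : ∀ v → IsSub G (bV v) (bE v)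
      tree  : ∀ v → IsOrientedTree G (bV v) (bE v)
      rootIn : ∀ v → bV v (root v)
      IIn    : ∀ v u → bI v u → bV v u
      OIn    : ∀ v u → bO v u → bV v u
      cover  : ∀ v u → bV v u → u ≡ root v ⊎ bI v u ⊎ bO v u
      rootNotI : ∀ v → ¬ bI v (root v)
      rootNotO : ∀ v → ¬ bO v (root v)
      IOdisj   : ∀ v u → bI v u → ¬ bO v u
      outArb : ∀ v → IsOutArb G (Single G (root v) ∪ᵥ bO v)
                       (InducedE G (bE v) (Single G (root v) ∪ᵥ bO v)) (root v)
      inArb  : ∀ v → IsInArb G (Single G (root v) ∪ᵥ bI v)
                       (InducedE G (bE v) (Single G (root v) ∪ᵥ bI v)) (root v)
      disj : ∀ v w → v ≢ w → ∀ u → bV v u → ¬ bV w u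
      eTail : ∀ e → (Single G (root (tail H e)) ∪ᵥ bO (tail H e)) (tail G (eImg e))
      eHead : ∀ e → (Single G (root (head H e)) ∪ᵥ bI (head H e)) (head G (eImg e))

  module _ (μ : BMModel) where
    open BMModel μ
    imgV : VPred G
    imgV u = ∃ λ v → bV v u
    imgE : EPred G
    imgE f = (∃ λ v → bE v f) ⊎ (∃ λ e → eImg e ≡ f)

  ProperSub : BMModel → BMModel → Set
  ProperSub μ' μ =
    (∀ u → imgV μ' u → imgV μ u) × (∀ f → imgE μ' f → imgE μ f) ×
    ((∃ λ u → imgV μ u × ¬ imgV μ' u) ⊎ (∃ λ f → imgE μ f × ¬ imgE μ' f))

  IsMinimal : BMModel → Set₁
  IsMinimal μ = ¬ (Σ BMModel λ μ' → ProperSub μ' μ)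

StronglyConnectedDigraph : Digraph → Set
StronglyConnectedDigraph H = StronglyConnected H (λ _ → ⊤) (λ _ → ⊤)

-- If some vertex u of O_x lies on none of the directed paths in μ(x) from
-- r_x to the tails of the edge images leaving x, then deleting from O_x
-- every such vertex (and symmetrically from I_x) leaves a butterfly minor
-- model of H whose image is a proper subdigraph of μ(H).  So in a minimal
-- model every u ∈ O_x reaches r_x: follow the out-arborescence to the tail
-- of an edge image leaving x, cross it to the in-arborescence of its head y,
-- walk to r_y, and return to r_x along images of a walk from y to x in H.
-- Dually r_x reaches every vertex of I_x, and the roots reach each other.
module Submission where

open import Defs
open import Data.Fin using (Fin)
open import Data.Fin.Properties using (_≟_; any?)
open import Data.List using (List; []; _∷_)
open import Data.List.Membership.Propositional using (_∈_)
open import Data.List.Relation.Unary.Any using (here; there)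
import Data.List.Relation.Unary.Any as Any
open import Data.List.Relation.Unary.Unique.Propositional using (Unique)
open import Data.Product using (∃; _×_; _,_; proj₁; proj₂)
open import Data.Sum using (_⊎_; inj₁; inj₂)
open import Data.Unit using (⊤; tt)
open import Data.Empty using (⊥-elim)
open import Relation.Nullary using (¬_; Dec; yes; no)
open import Relation.Nullary.Decidable using (_×-dec_)
open import Relation.Unary using (_⊆_)
open import Relation.Binary.PropositionalEquality using (_≡_; refl; sym; subst; cong)

module Walks (G : Digraph) where

  private variable
    V V' : VPred G
    E E' : EPred G
    a b c w : Vtx G

  verts : DWalk G V E a b → List (Vtx G)
  verts (dnil {u} _) = u ∷ []
  verts (dcons e _ _ p) = tail G e ∷ verts p

  start∈verts : (p : DWalk G V E a b) → a ∈ verts p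
  start∈verts (dnil _) = here refl
  start∈verts (dcons _ _ _ _) = here refl

  end∈verts : (p : DWalk G V E a b) → b ∈ verts p
  end∈verts (dnil _) = here refl
  end∈verts (dcons _ _ _ p) = there (end∈verts p)

  verts⊆V : (p : DWalk G V E a b) → w ∈ verts p → V w
  verts⊆V (dnil v) (here refl) = v
  verts⊆V (dcons _ v _ _) (here refl) = v
  verts⊆V (dcons _ _ _ p) (there w∈p) = verts⊆V p w∈p

  dmap : V ⊆ V' → E ⊆ E' → DWalk G V E a b → DWalk G V' E' a b
  dmap f g (dnil v) = dnil (f v)
  dmap f g (dcons e v x p) = dcons e (f v) (g x) (dmap f g p)

  _++_ : DWalk G V E a b → DWalk G V E b c → DWalk G V E a c
  dnil _ ++ q = q
  dcons e v x p ++ q = dcons e v x (p ++ q)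

  infixr 5 _++_

  splitAt : (p : DWalk G V E a b) → w ∈ verts p →
            DWalk G V E a w × DWalk G V E w b
  splitAt (dnil v) (here refl) = dnil v , dnil v
  splitAt (dcons e v x p) (here refl) = dnil v , dcons e v x p
  splitAt (dcons e v x p) (there w∈p) with splitAt p w∈p
  ... | q , r = dcons e v x q , r

  restrict : (p : DWalk G V E a b) → (∀ {u} → u ∈ verts p → V' u) →
             (∀ {f} → E f → V' (tail G f) → V' (head G f) → E' f) →
             DWalk G V' E' a b
  restrict (dnil _) onV onE = dnil (onV (here refl))
  restrict (dcons e _ x p) onV onE =
    dcons e (onV (here refl)) (onE x (onV (here refl)) (onV (there (start∈verts p))))
      (restrict p (λ u∈p → onV (there u∈p)) onE)

  restrict-verts : (p : DWalk G V E a b) (onV : ∀ {u} → u ∈ verts p → V' u)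
    (onE : ∀ {f} → E f → V' (tail G f) → V' (head G f) → E' f) →
    verts (restrict p onV onE) ≡ verts p
  restrict-verts (dnil _) onV onE = refl
  restrict-verts (dcons e _ _ p) onV onE =
    cong (tail G e ∷_) (restrict-verts p (λ u∈p → onV (there u∈p)) onE)

  ustart : UWalk G V E a b → V a
  ustart (unil v) = v
  ustart (ufwd _ v _ _) = v
  ustart (ubwd _ v _ _) = v

  _u++_ : UWalk G V E a b → UWalk G V E b c → UWalk G V E a c
  unil _ u++ q = q
  ufwd e v x p u++ q = ufwd e v x (p u++ q)
  ubwd e v x p u++ q = ubwd e v x (p u++ q)

  ureverse : UWalk G V E a b → UWalk G V E b a
  ureverse (unil v) = unil v
  ureverse (ufwd e v x p) = ureverse p u++ ubwd e (ustart p) x (unil v)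
  ureverse (ubwd e v x p) = ureverse p u++ ufwd e (ustart p) x (unil v)

  toUWalk : DWalk G V E a b → UWalk G V E a b
  toUWalk (dnil v) = unil v
  toUWalk (dcons e v x p) = ufwd e v x (toUWalk p)

  umap : V ⊆ V' → E ⊆ E' → UWalk G V E a b → UWalk G V' E' a b
  umap f g (unil v) = unil (f v)
  umap f g (ufwd e v x p) = ufwd e (f v) (g x) (umap f g p)
  umap f g (ubwd e v x p) = ubwd e (f v) (g x) (umap f g p)

  uedges-umap : (f : V ⊆ V') (g : E ⊆ E') (p : UWalk G V E a b) →
                uedges G (umap f g p) ≡ uedges G p
  uedges-umap f g (unil _) = refl
  uedges-umap f g (ufwd e _ _ p) = cong (e ∷_) (uedges-umap f g p)
  uedges-umap f g (ubwd e _ _ p) = cong (e ∷_) (uedges-umap f g p)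

  uinner-umap : (f : V ⊆ V') (g : E ⊆ E') (p : UWalk G V E a b) →
                uinner G (umap f g p) ≡ uinner G p
  uinner-umap f g (unil _) = refl
  uinner-umap f g (ufwd e _ _ p) = cong (tail G e ∷_) (uinner-umap f g p)
  uinner-umap f g (ubwd e _ _ p) = cong (head G e ∷_) (uinner-umap f g p)

  ¬HasUCycle-mono : V ⊆ V' → E ⊆ E' → ¬ HasUCycle G V' E' → ¬ HasUCycle G V E
  ¬HasUCycle-mono f g acyclic (u , c , nonempty , uniqueE , uniqueV) =
    acyclic (u , umap f g c ,
             (λ eq → nonempty (subst (_≡ []) (uedges-umap f g c) eq)) ,
             subst Unique (sym (uedges-umap f g c)) uniqueE ,
             subst Unique (sym (uinner-umap f g c)) uniqueV)

  orientedTree-viaRoot : ∀ {r V₀ E₀} → V r → (∀ u → V u → UWalk G V E r u) →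
    V ⊆ V₀ → E ⊆ E₀ → ¬ HasUCycle G V₀ E₀ → IsOrientedTree G V E
  orientedTree-viaRoot {r = r} Vr fromRoot V⊆V₀ E⊆E₀ acyclic =
    (r , Vr) ,
    (λ u w Vu Vw → ureverse (fromRoot u Vu) u++ fromRoot w Vw) ,
    ¬HasUCycle-mono V⊆V₀ E⊆E₀ acyclic

module Pruning {H G : Digraph} (μ : BMModel H G) where
  open BMModel μ
  open Walks G

  Out In : Fin (nV H) → VPred G
  Out x = Single G (root x) ∪ᵥ bO x
  In x = Single G (root x) ∪ᵥ bI x

  Out⊆bV : ∀ x → Out x ⊆ bV x
  Out⊆bV x (inj₁ refl) = rootIn x
  Out⊆bV x (inj₂ o) = OIn x _ o

  In⊆bV : ∀ x → In x ⊆ bV x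
  In⊆bV x (inj₁ refl) = rootIn x
  In⊆bV x (inj₂ i) = IIn x _ i

  outPath : (e : Fin (nE H)) →
    DWalk G (Out (tail H e)) (InducedE G (bE (tail H e)) (Out (tail H e)))
      (root (tail H e)) (tail G (eImg e))
  outPath e = proj₂ (proj₂ (outArb (tail H e))) _ (eTail e)

  inPath : (e : Fin (nE H)) →
    DWalk G (In (head H e)) (InducedE G (bE (head H e)) (In (head H e)))
      (head G (eImg e)) (root (head H e))
  inPath e = proj₂ (proj₂ (inArb (head H e))) _ (eHead e)

  OnOutPath OnInPath : Fin (nV H) → VPred G
  OnOutPath x u = ∃ λ e → tail H e ≡ x × u ∈ verts (outPath e)
  OnInPath x u = ∃ λ e → head H e ≡ x × u ∈ verts (inPath e)

  onOutPath? : ∀ x u → Dec (OnOutPath x u)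
  onOutPath? x u = any? λ e → (tail H e ≟ x) ×-dec Any.any? (u ≟_) (verts (outPath e))

  onInPath? : ∀ x u → Dec (OnInPath x u)
  onInPath? x u = any? λ e → (head H e ≟ x) ×-dec Any.any? (u ≟_) (verts (inPath e))

  prunedO prunedI prunedV : Fin (nV H) → VPred G
  prunedO x u = bO x u × OnOutPath x u
  prunedI x u = bI x u × OnInPath x u
  prunedV x u = u ≡ root x ⊎ prunedI x u ⊎ prunedO x u

  prunedE : Fin (nV H) → EPred G
  prunedE x = InducedE G (bE x) (prunedV x)

  prunedOut prunedIn : Fin (nV H) → VPred G
  prunedOut x = Single G (root x) ∪ᵥ prunedO x
  prunedIn x = Single G (root x) ∪ᵥ prunedI x

  prunedOutE prunedInE : Fin (nV H) → EPred G
  prunedOutE x = InducedE G (prunedE x) (prunedOut x)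
  prunedInE x = InducedE G (prunedE x) (prunedIn x)

  prunedV⊆bV : ∀ x → prunedV x ⊆ bV x
  prunedV⊆bV x (inj₁ refl) = rootIn x
  prunedV⊆bV x (inj₂ (inj₁ i)) = IIn x _ (proj₁ i)
  prunedV⊆bV x (inj₂ (inj₂ o)) = OIn x _ (proj₁ o)

  prunedOut⊆prunedV : ∀ x → prunedOut x ⊆ prunedV x
  prunedOut⊆prunedV x (inj₁ r) = inj₁ r
  prunedOut⊆prunedV x (inj₂ o) = inj₂ (inj₂ o)

  prunedIn⊆prunedV : ∀ x → prunedIn x ⊆ prunedV x
  prunedIn⊆prunedV x (inj₁ r) = inj₁ r
  prunedIn⊆prunedV x (inj₂ i) = inj₂ (inj₁ i)

  prunedOut⊆Out : ∀ x → prunedOut x ⊆ Out x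
  prunedOut⊆Out x (inj₁ r) = inj₁ r
  prunedOut⊆Out x (inj₂ o) = inj₂ (proj₁ o)

  prunedIn⊆In : ∀ x → prunedIn x ⊆ In x
  prunedIn⊆In x (inj₁ r) = inj₁ r
  prunedIn⊆In x (inj₂ i) = inj₂ (proj₁ i)

  outPath⊆prunedOut : ∀ e {u} → u ∈ verts (outPath e) → prunedOut (tail H e) u
  outPath⊆prunedOut e u∈p with verts⊆V (outPath e) u∈p
  ... | inj₁ r = inj₁ r
  ... | inj₂ o = inj₂ (o , e , refl , u∈p)

  inPath⊆prunedIn : ∀ e {u} → u ∈ verts (inPath e) → prunedIn (head H e) u
  inPath⊆prunedIn e u∈p with verts⊆V (inPath e) u∈p
  ... | inj₁ r = inj₁ r
  ... | inj₂ i = inj₂ (i , e , refl , u∈p)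

  prunedOut-reachable : ∀ x {w} → prunedOut x w →
                        DWalk G (prunedOut x) (prunedOutE x) (root x) w
  prunedOut-reachable x (inj₁ refl) = dnil (inj₁ refl)
  prunedOut-reachable .(tail H e) (inj₂ (_ , e , refl , w∈p)) =
    proj₁ (splitAt p (subst (_ ∈_) (sym (restrict-verts (outPath e) onV onE)) w∈p))
    where
    onV = outPath⊆prunedOut e
    onE : ∀ {f} → InducedE G (bE (tail H e)) (Out (tail H e)) f →
          prunedOut (tail H e) (tail G f) → prunedOut (tail H e) (head G f) →
          prunedOutE (tail H e) f
    onE (f∈E , _) t h = (f∈E , prunedOut⊆prunedV _ t , prunedOut⊆prunedV _ h) , t , h
    p = restrict (outPath e) onV onE

  prunedIn-coreachable : ∀ x {w} → prunedIn x w →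
                         DWalk G (prunedIn x) (prunedInE x) w (root x)
  prunedIn-coreachable x (inj₁ refl) = dnil (inj₁ refl)
  prunedIn-coreachable .(head H e) (inj₂ (_ , e , refl , w∈p)) =
    proj₂ (splitAt p (subst (_ ∈_) (sym (restrict-verts (inPath e) onV onE)) w∈p))
    where
    onV = inPath⊆prunedIn e
    onE : ∀ {f} → InducedE G (bE (head H e)) (In (head H e)) f →
          prunedIn (head H e) (tail G f) → prunedIn (head H e) (head G f) →
          prunedInE (head H e) f
    onE (f∈E , _) t h = (f∈E , prunedIn⊆prunedV _ t , prunedIn⊆prunedV _ h) , t , h
    p = restrict (inPath e) onV onE

  prunedV-connectedToRoot : ∀ x w → prunedV x w → UWalk G (prunedV x) (prunedE x) (root x) w
  prunedV-connectedToRoot x w (inj₁ refl) = unil (inj₁ refl)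
  prunedV-connectedToRoot x w (inj₂ (inj₁ i)) =
    ureverse (toUWalk (dmap (prunedIn⊆prunedV x) proj₁ (prunedIn-coreachable x (inj₂ i))))
  prunedV-connectedToRoot x w (inj₂ (inj₂ o)) =
    toUWalk (dmap (prunedOut⊆prunedV x) proj₁ (prunedOut-reachable x (inj₂ o)))

  pruned : BMModel H G
  pruned = record
    { bV = prunedV ; bE = prunedE ; root = root ; bI = prunedI ; bO = prunedO ; eImg = eImg
    ; sub = λ x f → proj₂
    ; tree = λ x → orientedTree-viaRoot (inj₁ refl) (prunedV-connectedToRoot x)
                     (prunedV⊆bV x) proj₁ (proj₂ (proj₂ (tree x)))
    ; rootIn = λ x → inj₁ refl
    ; IIn = λ x u i → inj₂ (inj₁ i)
    ; OIn = λ x u o → inj₂ (inj₂ o)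
    ; cover = λ x u v → v
    ; rootNotI = λ x i → rootNotI x (proj₁ i)
    ; rootNotO = λ x o → rootNotO x (proj₁ o)
    ; IOdisj = λ x u i o → IOdisj x u (proj₁ i) (proj₁ o)
    ; outArb = λ x →
        orientedTree-viaRoot (inj₁ refl)
          (λ w o → toUWalk (prunedOut-reachable x o))
          (prunedOut⊆Out x)
          (λ { ((f∈E , _) , t , h) → f∈E , prunedOut⊆Out x t , prunedOut⊆Out x h })
          (proj₂ (proj₂ (proj₁ (outArb x)))) ,
        inj₁ refl , λ w → prunedOut-reachable x
    ; inArb = λ x →
        orientedTree-viaRoot (inj₁ refl)
          (λ w i → ureverse (toUWalk (prunedIn-coreachable x i)))
          (prunedIn⊆In x)
          (λ { ((f∈E , _) , t , h) → f∈E , prunedIn⊆In x t , prunedIn⊆In x h })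
          (proj₂ (proj₂ (proj₁ (inArb x)))) ,
        inj₁ refl , λ w → prunedIn-coreachable x
    ; disj = λ x y x≢y u v w → disj x y x≢y u (prunedV⊆bV x v) (prunedV⊆bV y w)
    ; eTail = λ e → outPath⊆prunedOut e (end∈verts (outPath e))
    ; eHead = λ e → inPath⊆prunedIn e (start∈verts (inPath e))
    }

  imgV-pruned⊆ : ∀ u → imgV H G pruned u → imgV H G μ u
  imgV-pruned⊆ u (x , v) = x , prunedV⊆bV x v

  imgE-pruned⊆ : ∀ f → imgE H G pruned f → imgE H G μ f
  imgE-pruned⊆ f (inj₁ (x , f∈E)) = inj₁ (x , proj₁ f∈E)
  imgE-pruned⊆ f (inj₂ img) = inj₂ img

  offOutPath-pruned : ∀ x {u} → bO x u → ¬ OnOutPath x u → ¬ imgV H G pruned u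
  offOutPath-pruned x o off (y , v) with y ≟ x
  offOutPath-pruned x o off (.x , inj₁ refl) | yes refl = rootNotO x o
  offOutPath-pruned x o off (.x , inj₂ (inj₁ i)) | yes refl = IOdisj x _ (proj₁ i) o
  offOutPath-pruned x o off (.x , inj₂ (inj₂ o')) | yes refl = off (proj₂ o')
  ... | no y≢x = disj y x y≢x _ (prunedV⊆bV y v) (OIn x _ o)

  offInPath-pruned : ∀ x {u} → bI x u → ¬ OnInPath x u → ¬ imgV H G pruned u
  offInPath-pruned x i off (y , v) with y ≟ x
  offInPath-pruned x i off (.x , inj₁ refl) | yes refl = rootNotI x i
  offInPath-pruned x i off (.x , inj₂ (inj₁ i')) | yes refl = off (proj₂ i')
  offInPath-pruned x i off (.x , inj₂ (inj₂ o)) | yes refl = IOdisj x _ i (proj₁ o)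
  ... | no y≢x = disj y x y≢x _ (prunedV⊆bV y v) (IIn x _ i)

  minimal⇒onOutPath : IsMinimal H G μ → ∀ x {u} → bO x u → OnOutPath x u
  minimal⇒onOutPath minimal x {u} o with onOutPath? x u
  ... | yes on = on
  ... | no off = ⊥-elim (minimal (pruned , imgV-pruned⊆ , imgE-pruned⊆ ,
                                  inj₁ (u , (x , OIn x u o) , offOutPath-pruned x o off)))

  minimal⇒onInPath : IsMinimal H G μ → ∀ x {u} → bI x u → OnInPath x u
  minimal⇒onInPath minimal x {u} i with onInPath? x u
  ... | yes on = on
  ... | no off = ⊥-elim (minimal (pruned , imgV-pruned⊆ , imgE-pruned⊆ ,
                                  inj₁ (u , (x , IIn x u i) , offInPath-pruned x i off)))

module Reachability {H G : Digraph} (μ : BMModel H G) where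
  open BMModel μ
  open Walks G
  open Pruning μ

  _⇝_ : Vtx G → Vtx G → Set
  u ⇝ w = DWalk G (imgV H G μ) (imgE H G μ) u w

  liftOut : ∀ x {a b} → DWalk G (Out x) (InducedE G (bE x) (Out x)) a b → a ⇝ b
  liftOut x = dmap (λ v → x , Out⊆bV x v) (λ f∈E → inj₁ (x , proj₁ f∈E))

  liftIn : ∀ x {a b} → DWalk G (In x) (InducedE G (bE x) (In x)) a b → a ⇝ b
  liftIn x = dmap (λ v → x , In⊆bV x v) (λ f∈E → inj₁ (x , proj₁ f∈E))

  across : ∀ e {b} → head G (eImg e) ⇝ b → tail G (eImg e) ⇝ b
  across e = dcons (eImg e) (tail H e , Out⊆bV _ (eTail e)) (inj₂ (e , refl))

  edge⇝ : ∀ e → root (tail H e) ⇝ root (head H e)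
  edge⇝ e = liftOut _ (outPath e) ++ across e (liftIn _ (inPath e))

  walk⇝ : ∀ {x y} → DWalk H (λ _ → ⊤) (λ _ → ⊤) x y → root x ⇝ root y
  walk⇝ {x} (dnil _) = dnil (x , rootIn x)
  walk⇝ (dcons e _ _ p) = edge⇝ e ++ walk⇝ p

  module _ (sc : StronglyConnectedDigraph H) where

    root⇝root : ∀ x y → root x ⇝ root y
    root⇝root x y = walk⇝ (sc x y tt tt)

    onOutPath⇝root : ∀ x {u} → OnOutPath x u → u ⇝ root x
    onOutPath⇝root .(tail H e) (e , refl , u∈p) =
      liftOut _ (proj₂ (splitAt (outPath e) u∈p)) ++
      across e (liftIn _ (inPath e) ++ root⇝root (head H e) (tail H e))

    root⇝onInPath : ∀ x {w} → OnInPath x w → root x ⇝ w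
    root⇝onInPath .(head H e) (e , refl , w∈p) =
      root⇝root (head H e) (tail H e) ++
      liftOut _ (outPath e) ++ across e (liftIn _ (proj₁ (splitAt (inPath e) w∈p)))

    module _ (minimal : IsMinimal H G μ) where

      ⇝root : ∀ x {u} → bV x u → u ⇝ root x
      ⇝root x {u} v with cover x u v
      ... | inj₁ refl = dnil (x , rootIn x)
      ... | inj₂ (inj₁ i) = liftIn x (proj₂ (proj₂ (inArb x)) u (inj₂ i))
      ... | inj₂ (inj₂ o) = onOutPath⇝root x (minimal⇒onOutPath minimal x o)

      root⇝ : ∀ x {w} → bV x w → root x ⇝ w
      root⇝ x {w} v with cover x w v
      ... | inj₁ refl = dnil (x , rootIn x)
      ... | inj₂ (inj₁ i) = root⇝onInPath x (minimal⇒onInPath minimal x i)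
      ... | inj₂ (inj₂ o) = liftOut x (proj₂ (proj₂ (outArb x)) w (inj₂ o))

lemma2p3 : (H G : Digraph) → StronglyConnectedDigraph H →
    (μ : BMModel H G) → IsMinimal H G μ →
    StronglyConnected G (imgV H G μ) (imgE H G μ)
lemma2p3 H G sc μ minimal u w (x , u∈μx) (y , w∈μy) =
  ⇝root sc minimal x u∈μx ++ root⇝root sc x y ++ root⇝ sc minimal y w∈μy
  where
  open Walks G using (_++_)
  open Reachability μ
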